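{- For all integers $p,q>1$ there exist $N$ and Boolean functions $f,g:\{0,1\}^N\to\{0,1\}$ with $f\neq g$, $\mathrm{s}(f)=p$, $\mathrm{s}(g)=q$, and a point $c\in\{0,1\}^N$ such that $f(x)=g(x)$ for every $x$ at Hamming distance at most $\mathrm{s}(f)+\mathrm{s}(g)-1$ from $c$.
   Context: For $x\in\{0,1\}^N$ and $i\in[N]$, $x^i$ is $x$ with the $i$-th bit flipped. $\mathrm{s}(f,x)=|\{i: f(x)\neq f(x^i)\}|$ and $\mathrm{s}(f)=\max_x\mathrm{s}(f,x)$. -}

module Defs where

open import Data.Nat using (ℕ; zero; suc; _+_; _⊔_)
open import Data.Bool using (Bool; true; false; not; if_then_else_)
open import Data.Fin using (Fin; zero; suc; _≟_)
open import Relation.Nullary.Decidable using (⌊_⌋)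

-- A point of {0,1}^N is a function Fin N → Bool (false = 0, true = 1).
Point : ℕ → Set
Point N = Fin N → Bool

BoolFun : ℕ → Set
BoolFun N = Point N → Bool

flip : ∀ {N} → Point N → Fin N → Point N
flip x i j = if ⌊ i ≟ j ⌋ then not (x j) else x j

count : ∀ {N} → (Fin N → Bool) → ℕ
count {zero} P = 0
count {suc N} P = (if P zero then 1 else 0) + count {N} (λ i → P (suc i))

_≠ᵇ_ : Bool → Bool → Bool
false ≠ᵇ b = b
true ≠ᵇ b = not b

sensAt : ∀ {N} → BoolFun N → Point N → ℕ
sensAt f x = count (λ i → f x ≠ᵇ f (flip x i))

maxOver : ∀ N → (Point N → ℕ) → ℕ
maxOver zero h = h (λ ())
maxOver (suc N) h =
  maxOver N (λ x → h (λ { zero → false ; (suc i) → x i }))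
  ⊔ maxOver N (λ x → h (λ { zero → true ; (suc i) → x i }))

sens : ∀ {N} → BoolFun N → ℕ
sens {N} f = maxOver N (sensAt f)

hamming : ∀ {N} → Point N → Point N → ℕ
hamming x y = count (λ i → x i ≠ᵇ y i)

-- Let p ≥ q (the other case is symmetric) and N = p + q, split as r = p − q free coordinates
-- followed by q pairs. Let g(x) = 1 iff some pair reads (1,0), and let f agree with g except at
-- the all-ones point, where f = 1 > 0 = g. Building both one coordinate at a time, on the pairs
-- s(g,x) and s(f,x) are at most 2 where g = 1 and at most the number of pairs where g = 0, while
-- each free coordinate adds at most one to s(f) and nothing to s(g). All bounds are attained at
-- all-ones, so s(f) = r + q = p and s(g) = q. Finally f and g differ only at all-ones, at
-- distance N = s(f) + s(g) from all-zeros.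

module Submission where

open import Defs
open import Data.Bool using (Bool; true; false; not; if_then_else_)
open import Data.Fin using (Fin; zero; suc; _≟_)
open import Data.Nat using (ℕ; zero; suc; _+_; _∸_; _⊔_; _≤_; _<_; _>_; z≤n; s≤s; >-nonZero)
open import Data.Nat.Properties
  using ( ≤-refl; ≤-reflexive; ≤-trans; ≤-antisym; ≤-total; ≤-pred; m≤n+m; m≤pred[n]⇒suc[m]≤n
        ; ⊔-lub; m≤m⊔n; m≤n⊔m; +-mono-≤; +-identityʳ; +-suc; +-comm; +-assoc; m∸n+n≡m )
open import Data.Product using (Σ; _×_; _,_)
open import Data.Sum using (inj₁; inj₂)
open import Data.Vec.Functional using (head; tail)
open import Relation.Binary.PropositionalEquality
open import Relation.Nullary using (¬_; yes; no)
open import Relation.Nullary.Decidable using (⌊_⌋)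

bit : Bool → ℕ
bit b = if b then 1 else 0

bit≤1 : ∀ b → bit b ≤ 1
bit≤1 false = z≤n
bit≤1 true  = ≤-refl

≠ᵇ-refl : ∀ b → (b ≠ᵇ b) ≡ false
≠ᵇ-refl false = refl
≠ᵇ-refl true  = refl

-- A record, so that Extensional f determines f during unification.
record Extensional {N} {B : Set} (h : Point N → B) : Set where
  constructor extensional
  field ext : ∀ {x y : Point N} → x ≗ y → h x ≡ h y
open Extensional

ones zeros : ∀ {N} → Point N
ones  _ = true
zeros _ = false

count-cong : ∀ {N} {P Q : Fin N → Bool} → P ≗ Q → count P ≡ count Q
count-cong {zero}  P≗Q = refl
count-cong {suc N} P≗Q = cong₂ _+_ (cong bit (P≗Q zero)) (count-cong (λ i → P≗Q (suc i)))

count-false : ∀ N → count {N} (λ _ → false) ≡ 0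
count-false zero    = refl
count-false (suc N) = count-false N

flip-cong : ∀ {N} {x y : Point N} → x ≗ y → ∀ i → flip x i ≗ flip y i
flip-cong x≗y i j = cong (λ b → if ⌊ i ≟ j ⌋ then not b else b) (x≗y j)

tail-flip-suc : ∀ {N} (x : Point (suc N)) i → tail (flip x (suc i)) ≗ flip (tail x) i
tail-flip-suc x i j with i ≟ j
... | yes _ = refl
... | no  _ = refl

sensAt-cong : ∀ {N} {f : BoolFun N} → Extensional f → Extensional (sensAt f)
sensAt-cong f-ext = extensional λ x≗y →
  count-cong (λ i → cong₂ _≠ᵇ_ (ext f-ext x≗y) (ext f-ext (flip-cong x≗y i)))

maxOver-lub : ∀ N (h : Point N → ℕ) {B} → (∀ x → h x ≤ B) → maxOver N h ≤ B
maxOver-lub zero    h h≤B = h≤B _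
maxOver-lub (suc N) h h≤B = ⊔-lub (maxOver-lub N _ (λ _ → h≤B _)) (maxOver-lub N _ (λ _ → h≤B _))

maxOver-upperBound : ∀ N (h : Point N → ℕ) → Extensional h → ∀ w → h w ≤ maxOver N h

-- e stands for the extended lambda with which maxOver prepends the first coordinate.
maxOver-upperBound-prefix : ∀ N (h : Point (suc N) → ℕ) → Extensional h →
  ∀ w (e : Point N → Point (suc N)) → (∀ x → e x zero ≡ w zero) → (∀ x i → e x (suc i) ≡ x i) → h w ≤ maxOver N (λ x → h (e x))
maxOver-upperBound-prefix N h h-ext w e e₀ eₛ =
  ≤-trans (≤-reflexive w≈) (maxOver-upperBound N _ he-ext (tail w))
  where
  w≈ : h w ≡ h (e (tail w))
  w≈ = ext h-ext (λ { zero → sym (e₀ _) ; (suc i) → sym (eₛ _ i) })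
  he-ext : Extensional (λ x → h (e x))
  he-ext = extensional λ x≗y → ext h-ext λ
    { zero    → trans (e₀ _) (sym (e₀ _))
    ; (suc i) → trans (eₛ _ i) (trans (x≗y i) (sym (eₛ _ i))) }

maxOver-upperBound zero    h h-ext w = ≤-reflexive (ext h-ext (λ ()))
maxOver-upperBound (suc N) h h-ext w with w zero in w₀
... | false = ≤-trans (maxOver-upperBound-prefix N h h-ext w _ (λ _ → sym w₀) (λ _ _ → refl))
                      (m≤m⊔n _ _)
... | true  = ≤-trans (maxOver-upperBound-prefix N h h-ext w _ (λ _ → sym w₀) (λ _ _ → refl))
                      (m≤n⊔m _ _)

sens-≡ : ∀ {N} {f : BoolFun N} {m} → Extensional f →
  (∀ x → sensAt f x ≤ m) → ∀ w → sensAt f w ≡ m → sens f ≡ m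
sens-≡ {N} f-ext ≤m w w≡m =
  ≤-antisym (maxOver-lub N _ ≤m)
            (≤-trans (≤-reflexive (sym w≡m)) (maxOver-upperBound N _ (sensAt-cong f-ext) w))

select : ∀ {N} → BoolFun N → BoolFun N → BoolFun (suc N)
select f g x = if head x then f (tail x) else g (tail x)

const-cong : ∀ {N} (b : Bool) → Extensional {N} (λ _ → b)
const-cong b = extensional λ _ → refl

select-cong : ∀ {N} {f g : BoolFun N} → Extensional f → Extensional g → Extensional (select f g)
select-cong {f = f} {g} f-ext g-ext = extensional λ {x} {y} x≗y → select-respects x y x≗y
  where
  select-respects : ∀ x y → x ≗ y → select f g x ≡ select f g y
  select-respects x y x≗y rewrite x≗y zero with y zero
  ... | true  = ext f-ext (λ i → x≗y (suc i))
  ... | false = ext g-ext (λ i → x≗y (suc i))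

sensAt-select : ∀ {N} {f g : BoolFun N} → Extensional f → Extensional g → ∀ x →
  sensAt (select f g) x ≡ bit (select f g x ≠ᵇ select g f x) + sensAt (if head x then f else g) (tail x)
sensAt-select {f = f} {g} f-ext g-ext x with x zero
... | true  = cong (bit (f (tail x) ≠ᵇ g (tail x)) +_)
                   (count-cong (λ i → cong (f (tail x) ≠ᵇ_) (ext f-ext (tail-flip-suc x i))))
... | false = cong (bit (g (tail x) ≠ᵇ f (tail x)) +_)
                   (count-cong (λ i → cong (g (tail x) ≠ᵇ_) (ext g-ext (tail-flip-suc x i))))

sensAt-select-self : ∀ {N} {g : BoolFun N} → Extensional g → ∀ x →
  sensAt (select g g) x ≡ sensAt g (tail x)
sensAt-select-self {g = g} g-ext x with x zero | sensAt-select g-ext g-ext x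
... | true  | eq = trans eq (cong (λ b → bit b + sensAt g (tail x)) (≠ᵇ-refl (g (tail x))))
... | false | eq = trans eq (cong (λ b → bit b + sensAt g (tail x)) (≠ᵇ-refl (g (tail x))))

select-sensAt-≤ : ∀ {N} {f g : BoolFun N} {m} → Extensional f → Extensional g →
  (∀ y → sensAt f y ≤ m) → (∀ y → sensAt g y ≤ m) → ∀ x → sensAt (select f g) x ≤ suc m
select-sensAt-≤ {f = f} {g} f-ext g-ext f-≤ g-≤ x
  rewrite sensAt-select f-ext g-ext x with x zero
... | true  = +-mono-≤ (bit≤1 (f (tail x) ≠ᵇ g (tail x))) (f-≤ (tail x))
... | false = +-mono-≤ (bit≤1 (g (tail x) ≠ᵇ f (tail x))) (g-≤ (tail x))

AgreeOffOnes : ∀ {N} → BoolFun N → BoolFun N → Set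
AgreeOffOnes {N} f g = ∀ x → hamming x zeros < N → f x ≡ g x

select-agreeOffOnes : ∀ {N} {f g : BoolFun N} h → AgreeOffOnes f g → AgreeOffOnes (select f h) (select g h)
select-agreeOffOnes h f≈g x with x zero
... | true  = λ d → f≈g (tail x) (≤-pred d)
... | false = λ _ → refl

double : ℕ → ℕ
double zero    = zero
double (suc k) = suc (suc (double k))

-- true iff some pair (x₂ᵢ, x₂ᵢ₊₁) equals (1, 0)
someTen : ∀ k → BoolFun (double k)
someTen zero    = λ _ → false
someTen (suc k) = select (select (someTen k) (λ _ → true)) (select (someTen k) (someTen k))

someTenOrOnes : ∀ k → BoolFun (double k)
someTenOrOnes zero    = λ _ → true
someTenOrOnes (suc k) = select (select (someTenOrOnes k) (λ _ → true)) (select (someTen k) (someTen k))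

someTen-cong : ∀ k → Extensional (someTen k)
someTen-cong zero    = const-cong false
someTen-cong (suc k) = select-cong (select-cong (someTen-cong k) (const-cong true))
                                   (select-cong (someTen-cong k) (someTen-cong k))

someTenOrOnes-cong : ∀ k → Extensional (someTenOrOnes k)
someTenOrOnes-cong zero    = const-cong true
someTenOrOnes-cong (suc k) = select-cong (select-cong (someTenOrOnes-cong k) (const-cong true))
                                         (select-cong (someTen-cong k) (someTen-cong k))

someTen-ones : ∀ k → someTen k ones ≡ false
someTen-ones zero    = refl
someTen-ones (suc k) = someTen-ones k

someTenOrOnes-ones : ∀ k → someTenOrOnes k ones ≡ true
someTenOrOnes-ones zero    = refl
someTenOrOnes-ones (suc k) = someTenOrOnes-ones k

someTen⇒someTenOrOnes : ∀ k x → someTen k x ≡ true → someTenOrOnes k x ≡ true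
someTen⇒someTenOrOnes zero    x ()
someTen⇒someTenOrOnes (suc k) x with x zero | x (suc zero)
... | true  | true  = someTen⇒someTenOrOnes k _
... | true  | false = λ _ → refl
... | false | _     = λ eq → eq

someTen-agreeOffOnes : ∀ k → AgreeOffOnes (someTenOrOnes k) (someTen k)
someTen-agreeOffOnes zero    _ ()
someTen-agreeOffOnes (suc k) =
  select-agreeOffOnes (select (someTen k) (someTen k))
                      (select-agreeOffOnes (λ _ → true) (someTen-agreeOffOnes k))

module _ (k : ℕ) where

  pair-11-≤ : ∀ g₀ h₀ {s} → (g₀ ≡ true → h₀ ≡ true) → s ≤ (if g₀ then 2 else k) →
    bit (h₀ ≠ᵇ g₀) + (bit (h₀ ≠ᵇ true) + s) ≤ (if g₀ then 2 else suc k)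
  pair-11-≤ true  h₀ g⇒h₀ s≤ rewrite g⇒h₀ refl = s≤
  pair-11-≤ false true  _ s≤ = s≤s s≤
  pair-11-≤ false false _ s≤ = s≤s s≤

  pair-0b-≤ : ∀ g₀ c {s} → (g₀ ≡ true → c ≡ true) → s ≤ (if g₀ then 2 else k) →
    bit (g₀ ≠ᵇ c) + s ≤ (if g₀ then 2 else suc k)
  pair-0b-≤ true  c g⇒c s≤ rewrite g⇒c refl = s≤
  pair-0b-≤ false c _   s≤ = +-mono-≤ (bit≤1 c) s≤

-- One step for both someTen (h = g) and someTenOrOnes (h ≠ g): the bound is read off g alone.
pair-sensAt-≤ : ∀ {N} k (g h : BoolFun N) → Extensional g → Extensional h →
  (∀ y → g y ≡ true → h y ≡ true) →
  (∀ y → sensAt g y ≤ (if g y then 2 else k)) → (∀ y → sensAt h y ≤ (if g y then 2 else k)) →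
  ∀ x → sensAt (select (select h (λ _ → true)) (select g g)) x
          ≤ (if select (select g (λ _ → true)) (select g g) x then 2 else suc k)
pair-sensAt-≤ {N} k g h g-ext h-ext g⇒h g-≤ h-≤ x
  rewrite sensAt-select (select-cong h-ext (const-cong true)) (select-cong g-ext g-ext) x
  with x zero
... | true rewrite sensAt-select h-ext (const-cong true) (tail x) with x (suc zero)
...   | true  = pair-11-≤ k _ _ (g⇒h _) (h-≤ _)
...   | false rewrite count-false N =
  +-mono-≤ (bit≤1 (not (g y))) (≤-trans (≤-reflexive (+-identityʳ _)) (bit≤1 (not (h y))))
    where y = tail (tail x)
pair-sensAt-≤ k g h g-ext h-ext g⇒h g-≤ h-≤ x | false
  rewrite sensAt-select-self g-ext (tail x) with x (suc zero)
... | true  = pair-0b-≤ k _ _ (g⇒h _) (g-≤ _)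
... | false = pair-0b-≤ k _ _ (λ _ → refl) (g-≤ _)

someTen-sensAt-≤ : ∀ k x → sensAt (someTen k) x ≤ (if someTen k x then 2 else k)
someTen-sensAt-≤ zero    x = z≤n
someTen-sensAt-≤ (suc k) =
  pair-sensAt-≤ k (someTen k) (someTen k) (someTen-cong k) (someTen-cong k) (λ _ g≡t → g≡t)
                (someTen-sensAt-≤ k) (someTen-sensAt-≤ k)

someTenOrOnes-sensAt-≤ : ∀ k x → sensAt (someTenOrOnes k) x ≤ (if someTen k x then 2 else k)
someTenOrOnes-sensAt-≤ zero    x = z≤n
someTenOrOnes-sensAt-≤ (suc k) =
  pair-sensAt-≤ k (someTen k) (someTenOrOnes k) (someTen-cong k) (someTenOrOnes-cong k)
                (someTen⇒someTenOrOnes k) (someTen-sensAt-≤ k) (someTenOrOnes-sensAt-≤ k)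

pair-sensAt-ones : ∀ {N} (g h : BoolFun N) → Extensional g → Extensional h → g ones ≡ false →
  sensAt (select (select h (λ _ → true)) (select g g)) ones ≡ suc (sensAt h ones)
pair-sensAt-ones g h g-ext h-ext g₁≡f
  rewrite sensAt-select (select-cong h-ext (const-cong true)) (select-cong g-ext g-ext) ones
        | sensAt-select h-ext (const-cong true) ones
        | g₁≡f
  with h ones
... | true  = refl
... | false = refl

someTen-sensAt-ones : ∀ k → sensAt (someTen k) ones ≡ k
someTen-sensAt-ones zero    = refl
someTen-sensAt-ones (suc k) =
  trans (pair-sensAt-ones _ _ (someTen-cong k) (someTen-cong k) (someTen-ones k))
        (cong suc (someTen-sensAt-ones k))

someTenOrOnes-sensAt-ones : ∀ k → sensAt (someTenOrOnes k) ones ≡ k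
someTenOrOnes-sensAt-ones zero    = refl
someTenOrOnes-sensAt-ones (suc k) =
  trans (pair-sensAt-ones _ _ (someTen-cong k) (someTenOrOnes-cong k) (someTen-ones k))
        (cong suc (someTenOrOnes-sensAt-ones k))

witnessG : ∀ q r → BoolFun (r + double q)
witnessG q zero    = someTen q
witnessG q (suc r) = select (witnessG q r) (witnessG q r)

witnessF : ∀ q r → BoolFun (r + double q)
witnessF q zero    = someTenOrOnes q
witnessF q (suc r) = select (witnessF q r) (witnessG q r)

witnessG-cong : ∀ q r → Extensional (witnessG q r)
witnessG-cong q zero    = someTen-cong q
witnessG-cong q (suc r) = select-cong (witnessG-cong q r) (witnessG-cong q r)

witnessF-cong : ∀ q r → Extensional (witnessF q r)
witnessF-cong q zero    = someTenOrOnes-cong q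
witnessF-cong q (suc r) = select-cong (witnessF-cong q r) (witnessG-cong q r)

witnessG-ones : ∀ q r → witnessG q r ones ≡ false
witnessG-ones q zero    = someTen-ones q
witnessG-ones q (suc r) = witnessG-ones q r

witnessF-ones : ∀ q r → witnessF q r ones ≡ true
witnessF-ones q zero    = someTenOrOnes-ones q
witnessF-ones q (suc r) = witnessF-ones q r

if-≤ : ∀ {q} b → 2 ≤ q → (if b then 2 else q) ≤ q
if-≤ true  2≤q = 2≤q
if-≤ false _   = ≤-refl

witnessG-sensAt-≤ : ∀ q r → 2 ≤ q → ∀ x → sensAt (witnessG q r) x ≤ q
witnessG-sensAt-≤ q zero    2≤q x = ≤-trans (someTen-sensAt-≤ q x) (if-≤ (someTen q x) 2≤q)
witnessG-sensAt-≤ q (suc r) 2≤q x =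
  ≤-trans (≤-reflexive (sensAt-select-self (witnessG-cong q r) x)) (witnessG-sensAt-≤ q r 2≤q (tail x))

witnessF-sensAt-≤ : ∀ q r → 2 ≤ q → ∀ x → sensAt (witnessF q r) x ≤ r + q
witnessF-sensAt-≤ q zero    2≤q x = ≤-trans (someTenOrOnes-sensAt-≤ q x) (if-≤ (someTen q x) 2≤q)
witnessF-sensAt-≤ q (suc r) 2≤q =
  select-sensAt-≤ (witnessF-cong q r) (witnessG-cong q r) (witnessF-sensAt-≤ q r 2≤q)
                  (λ y → ≤-trans (witnessG-sensAt-≤ q r 2≤q y) (m≤n+m q r))

witnessG-sensAt-ones : ∀ q r → sensAt (witnessG q r) ones ≡ q
witnessG-sensAt-ones q zero    = someTen-sensAt-ones q
witnessG-sensAt-ones q (suc r) =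
  trans (sensAt-select-self (witnessG-cong q r) ones) (witnessG-sensAt-ones q r)

witnessF-sensAt-ones : ∀ q r → sensAt (witnessF q r) ones ≡ r + q
witnessF-sensAt-ones q zero    = someTenOrOnes-sensAt-ones q
witnessF-sensAt-ones q (suc r) =
  trans (sensAt-select (witnessF-cong q r) (witnessG-cong q r) ones)
        (cong₂ (λ b s → bit b + s) (cong₂ _≠ᵇ_ (witnessF-ones q r) (witnessG-ones q r))
                                   (witnessF-sensAt-ones q r))

witness-agreeOffOnes : ∀ q r → AgreeOffOnes (witnessF q r) (witnessG q r)
witness-agreeOffOnes q zero    = someTen-agreeOffOnes q
witness-agreeOffOnes q (suc r) = select-agreeOffOnes (witnessG q r) (witness-agreeOffOnes q r)

double≡+ : ∀ k → double k ≡ k + k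
double≡+ zero    = refl
double≡+ (suc k) = cong suc (trans (cong suc (double≡+ k)) (sym (+-suc k k)))

double-pos : ∀ k → 1 ≤ k → double k > 0
double-pos (suc k) _ = s≤s z≤n

≤∸1⇒< : ∀ {m n} → n > 0 → m ≤ n ∸ 1 → m < n
≤∸1⇒< n>0 = m≤pred[n]⇒suc[m]≤n {{>-nonZero n>0}}

AgreeingPair : ℕ → ℕ → Set
AgreeingPair p q =
    Σ ℕ λ N → Σ (BoolFun N) λ f → Σ (BoolFun N) λ g →
    (¬ (∀ x → f x ≡ g x)) × sens f ≡ p × sens g ≡ q ×
    (Σ (Point N) λ c →
    ∀ x → hamming x c ≤ sens f + sens g ∸ 1 → f x ≡ g x)

agreeingPair-swap : ∀ {p q} → AgreeingPair q p → AgreeingPair p q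
agreeingPair-swap (N , f , g , f≉g , sf , sg , c , agree) =
  N , g , f , (λ g≈f → f≉g (λ x → sym (g≈f x))) , sg , sf , c ,
  λ x d → sym (agree x (subst (λ n → hamming x c ≤ n ∸ 1) (+-comm (sens g) (sens f)) d))

agreeingPair : ∀ q r → 2 ≤ q → AgreeingPair (r + q) q
agreeingPair q r 2≤q =
  r + double q , f , g , f≉g , sens-f , sens-g , zeros ,
  λ x d → witness-agreeOffOnes q r x (≤∸1⇒< N>0 (subst (λ n → hamming x zeros ≤ n ∸ 1) sum≡N d))
  where
  f = witnessF q r
  g = witnessG q r
  f≉g : ¬ (∀ x → f x ≡ g x)
  f≉g f≈g with trans (sym (witnessF-ones q r)) (trans (f≈g ones) (witnessG-ones q r))
  ... | ()
  sens-f : sens f ≡ r + q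
  sens-f = sens-≡ (witnessF-cong q r) (witnessF-sensAt-≤ q r 2≤q) ones (witnessF-sensAt-ones q r)
  sens-g : sens g ≡ q
  sens-g = sens-≡ (witnessG-cong q r) (witnessG-sensAt-≤ q r 2≤q) ones (witnessG-sensAt-ones q r)
  sum≡N : sens f + sens g ≡ r + double q
  sum≡N = begin
    sens f + sens g ≡⟨ cong₂ _+_ sens-f sens-g ⟩
    r + q + q       ≡⟨ +-assoc r q q ⟩
    r + (q + q)     ≡⟨ cong (r +_) (double≡+ q) ⟨
    r + double q    ∎
    where open ≡-Reasoning
  N>0 : r + double q > 0
  N>0 = ≤-trans (double-pos q (≤-trans (s≤s z≤n) 2≤q)) (m≤n+m (double q) r)

proposition1 : (p q : ℕ) → 1 < p → 1 < q →
    Σ ℕ λ N → Σ (BoolFun N) λ f → Σ (BoolFun N) λ g →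
    (¬ (∀ x → f x ≡ g x)) × sens f ≡ p × sens g ≡ q ×
    (Σ (Point N) λ c →
    ∀ x → hamming x c ≤ sens f + sens g ∸ 1 → f x ≡ g x)
proposition1 p q 1<p 1<q with ≤-total q p
... | inj₁ q≤p = subst (λ n → AgreeingPair n q) (m∸n+n≡m q≤p) (agreeingPair q (p ∸ q) 1<q)
... | inj₂ p≤q =
  agreeingPair-swap (subst (λ n → AgreeingPair n p) (m∸n+n≡m p≤q) (agreeingPair p (q ∸ p) 1<p))
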